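{- Let $(C,\sqsubseteq)$ be a complete lattice, $b\colon C\to C$ a monotone map and $f\in C$. Let $[C\to C]$ be the complete lattice of monotone maps on $C$ ordered pointwise, and define $B\colon[C\to C]\to[C\to C]$ by $B(a)=\bigsqcup\{c\in[C\to C]\mid c\circ b\sqsubseteq b\circ a,\ c(f)\sqsubseteq f\}$. Then $B$ is monotone, and for all $a,a'\in[C\to C]$: $a'\sqsubseteq B(a)$ if and only if $a'\circ b\sqsubseteq b\circ a$ and $a'(f)\sqsubseteq f$. -}

module Defs where

open import Level using (Level; _⊔_; Lift; lift) renaming (suc to lsuc)
open import Data.Product using (Σ; _×_; _,_; proj₁; proj₂)
open import Relation.Unary using (Pred)
open import Relation.Binary.Core using (Rel)
open import Relation.Binary.Structures using (IsPartialOrder; IsPreorder; IsEquivalence)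
open import Relation.Binary.PropositionalEquality using (_≡_) renaming (refl to ≡-refl)

record CompleteLattice (c ℓ₁ ℓ₂ : Level) : Set (lsuc (c ⊔ ℓ₁ ⊔ ℓ₂)) where
  infix 4 _≈_ _≤_
  field
    Carrier        : Set c
    _≈_            : Rel Carrier ℓ₁
    _≤_            : Rel Carrier ℓ₂
    isPartialOrder : IsPartialOrder _≈_ _≤_
    ⋁              : Pred Carrier (c ⊔ ℓ₁ ⊔ ℓ₂) → Carrier
    ⋁-upper        : ∀ S x → S x → x ≤ ⋁ S
    ⋁-least        : ∀ S z → (∀ x → S x → x ≤ z) → ⋁ S ≤ z

  open IsPartialOrder isPartialOrder public

module _ {c ℓ₁ ℓ₂} (C : CompleteLattice c ℓ₁ ℓ₂) where
  open CompleteLattice C hiding (refl)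

  record MonoMap : Set (c ⊔ ℓ₂) where
    constructor mono
    field
      fun   : Carrier → Carrier
      monot : ∀ {x y} → x ≤ y → fun x ≤ fun y
  open MonoMap public

  _∘ᵐ_ : MonoMap → MonoMap → MonoMap
  g ∘ᵐ h = mono (λ x → fun g (fun h x)) (λ p → monot g (monot h p))

  _≈ᵐ_ : Rel MonoMap (c ⊔ ℓ₁)
  g ≈ᵐ h = ∀ x → fun g x ≈ fun h x

  _⊑ᵐ_ : Rel MonoMap (c ⊔ ℓ₂)
  g ⊑ᵐ h = ∀ x → fun g x ≤ fun h x

  ⋁ᵐ : Pred MonoMap (c ⊔ ℓ₁ ⊔ ℓ₂) → MonoMap
  ⋁ᵐ S = mono F F-mono
    where
      F : Carrier → Carrier
      F x = ⋁ (λ y → Σ MonoMap (λ g → S g × y ≡ fun g x))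
      F-mono : ∀ {x y} → x ≤ y → F x ≤ F y
      F-mono {x} {y} p = ⋁-least _ _ λ { z (g , s , ≡-refl) →
        trans (monot g p) (⋁-upper _ _ (g , s , ≡-refl)) }

  MonoLattice : CompleteLattice (c ⊔ ℓ₂) (c ⊔ ℓ₁) (c ⊔ ℓ₂)
  MonoLattice = record
    { Carrier = MonoMap
    ; _≈_ = _≈ᵐ_
    ; _≤_ = _⊑ᵐ_
    ; isPartialOrder = record
      { isPreorder = record
        { isEquivalence = record
          { refl = λ x → Eq.refl
          ; sym = λ p x → Eq.sym (p x)
          ; trans = λ p q x → Eq.trans (p x) (q x) }
        ; reflexive = λ p x → reflexive (p x)
        ; trans = λ p q x → trans (p x) (q x) }
      ; antisym = λ p q x → antisym (p x) (q x) }
    ; ⋁ = ⋁ᵐ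
    ; ⋁-upper = λ S g s x → ⋁-upper _ _ (g , s , ≡-refl)
    ; ⋁-least = λ S z h x → ⋁-least _ _ λ { y (g , s , ≡-refl) → h g s x }
    }

  B : (b : MonoMap) (f : Carrier) → MonoMap → MonoMap
  B b f a = CompleteLattice.⋁ MonoLattice
    (λ g → Lift (c ⊔ ℓ₁ ⊔ ℓ₂) (((g ∘ᵐ b) ⊑ᵐ (b ∘ᵐ a)) × (fun g f ≤ f)))

module Submission where

-- The operator B(a) = ⨆ { g | g ∘ b ⊑ b ∘ a , g(f) ⊑ f } is the join of the
-- set of "a-admissible" monotone maps.  The whole lemma rests on two facts
-- about these sets:
--
--   * admissibility is antitone in the bound: if a ⊑ a′ then every
--     a-admissible map is a′-admissible (because b is monotone);
--   * admissibility is closed under joins: both conditions say that a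
--     pointwise value lies below a fixed bound, and a join lies below any
--     common upper bound.  Hence B(a) is itself a-admissible, i.e. it is the
--     greatest a-admissible map.

open import Defs
open import Level using (Level; Lift; lift; _⊔_)
open import Data.Product using (_×_; _,_)
open import Function.Bundles using (_⇔_; mk⇔)
open import Relation.Binary.PropositionalEquality using () renaming (refl to ≡-refl)

module Admissibility {c ℓ₁ ℓ₂ : Level} (C : CompleteLattice c ℓ₁ ℓ₂)
                     (b : MonoMap C) (f : CompleteLattice.Carrier C) where
  open CompleteLattice C
  open CompleteLattice (MonoLattice C) using ()
    renaming (_≤_ to _⊑_; ⋁-upper to ⨆-upper; ⋁-least to ⨆-least)

  Admissible : MonoMap C → MonoMap C → Set (c ⊔ ℓ₂)
  Admissible a g = (_∘ᵐ_ C g b ⊑ _∘ᵐ_ C b a) × (fun g f ≤ f)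

  AdmissibleSet : MonoMap C → MonoMap C → Set (c ⊔ ℓ₁ ⊔ ℓ₂)
  AdmissibleSet a g = Lift (c ⊔ ℓ₁ ⊔ ℓ₂) (Admissible a g)

  admissible-weaken : ∀ a a′ g → a ⊑ a′ → Admissible a g → Admissible a′ g
  admissible-weaken a a′ g a⊑a′ (gb⊑ba , gf≤f) =
    (λ x → trans (gb⊑ba x) (monot b (a⊑a′ x))) , gf≤f

  admissible-downward : ∀ a g h → g ⊑ h → Admissible a h → Admissible a g
  admissible-downward a g h g⊑h (hb⊑ba , hf≤f) =
    (λ x → trans (g⊑h (fun b x)) (hb⊑ba x)) , trans (g⊑h f) hf≤f

  -- The join of all a-admissible maps is a-admissible: at every point the
  -- join is a join of values each lying below the required bound.
  B-admissible : ∀ a → Admissible a (B C b f a)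
  B-admissible a =
      (λ x → ⋁-least _ _ λ { _ (g , lift (gb⊑ba , _) , ≡-refl) → gb⊑ba x })
    , ⋁-least _ _ λ { _ (g , lift (_ , gf≤f) , ≡-refl) → gf≤f }

  B-monotone : ∀ a a′ → a ⊑ a′ → B C b f a ⊑ B C b f a′
  B-monotone a a′ a⊑a′ = ⨆-least (AdmissibleSet a) (B C b f a′)
    λ { g (lift adm) →
          ⨆-upper (AdmissibleSet a′) g (lift (admissible-weaken a a′ g a⊑a′ adm)) }

  below-B⇔admissible : ∀ a a′ → (a′ ⊑ B C b f a) ⇔ Admissible a a′
  below-B⇔admissible a a′ = mk⇔
    (λ a′⊑Ba → admissible-downward a a′ (B C b f a) a′⊑Ba (B-admissible a))
    (λ adm → ⨆-upper (AdmissibleSet a) a′ (lift adm))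

lemma9p14 : ∀ {c ℓ₁ ℓ₂ : Level} (C : CompleteLattice c ℓ₁ ℓ₂)
    (b : MonoMap C) (f : CompleteLattice.Carrier C) →
    let open CompleteLattice (MonoLattice C) using () renaming (_≤_ to _⊑_) in
    (∀ a a′ → a ⊑ a′ → B C b f a ⊑ B C b f a′)
    × (∀ a a′ → (a′ ⊑ B C b f a) ⇔
    ((_∘ᵐ_ C a′ b ⊑ _∘ᵐ_ C b a) × (CompleteLattice._≤_ C (fun a′ f) f)))
lemma9p14 C b f = B-monotone , below-B⇔admissible
  where open Admissibility C b f
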